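{- Let $T$ be a text of length $n$ over $\Sigma$ and consider its implicit suffix tree. Let $u$ be a branching node, $y\in\Sigma$, and $S:=\mathrm{str}(u)$. If $v := \mathrm{child}(u,y)$ is a leaf and the edge $uv$ contains no implicit node, then $Sy$ is unique in $T$, i.e. $f(Sy)=1$.
   Context: $\Sigma$ is a constant-size alphabet; $f(P)$ is the number of occurrences of a string $P$ in $T$; a suffix of $T$ is repeated if it occurs at least twice in $T$. The implicit suffix tree of $T$ is the compacted trie of all suffixes of $T$ (no end sentinel is appended): it is obtained from the trie of all suffixes of $T$ by keeping as explicit nodes only the root, the nodes with at least two children (branching nodes), and the leaves (the trie nodes with no children; they correspond exactly to the suffixes of $T$ that are not repeated), and compressing every other path into a single edge labelled by the concatenated string. For a node $u$, $\mathrm{str}(u)$ is the concatenation of edge labels from the root to $u$, $\mathrm{depth}(u) = |\mathrm{str}(u)|$, $\mathrm{parent}(u)$ is its parent, and $\mathrm{child}(u,y)$ is the child of $u$ whose edge label starts with $y$. A locus is a pair $(u,d)$ with $u$ a non-root node and $\mathrm{depth}(\mathrm{parent}(u)) < d \le \mathrm{depth}(u)$; it lies within the edge $(\mathrm{parent}(u),u)$ and represents the string $\mathrm{str}(u)[1\ldots d]$. An implicit node is a locus $(u,d)$ such that $\mathrm{str}(u)[1\ldots d]$ is a repeated suffix of $T$; the edge $(\mathrm{parent}(u),u)$ contains an implicit node if some such locus lies on it. -}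

module Defs where

open import Data.Nat using (ℕ; zero; suc; _+_; _≤_; _<_)
open import Data.Fin using (Fin; _≟_)
open import Data.List using (List; []; _∷_; _++_; _∷ʳ_; drop; take; length)
open import Data.Bool using (Bool; true; false; _∧_; if_then_else_)
open import Data.Product using (Σ; ∃; ∃-syntax; _×_; _,_)
open import Data.Sum using (_⊎_)
open import Relation.Nullary using (¬_; does)
open import Relation.Binary.PropositionalEquality using (_≡_; _≢_)

-- Alphabet: Fin σ (a finite, constant-size alphabet).
-- A text / string is a List (Fin σ); positions are 0-based.

prefixᵇ : ∀ {σ} → List (Fin σ) → List (Fin σ) → Bool
prefixᵇ []      _       = true
prefixᵇ (_ ∷ _) []      = false
prefixᵇ (a ∷ p) (b ∷ t) = does (a ≟ b) ∧ prefixᵇ p t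

-- f(P) = number of occurrences of P in T, i.e. the number of starting
-- positions i ∈ [0, |T|) such that P is a prefix of T[i..].
occ : ∀ {σ} → List (Fin σ) → List (Fin σ) → ℕ
occ P []         = 0
occ P (x ∷ xs)   = (if prefixᵇ P (x ∷ xs) then 1 else 0) + occ P xs

IsPrefix : ∀ {σ} → List (Fin σ) → List (Fin σ) → Set
IsPrefix P L = ∃[ R ] P ++ R ≡ L

IsSubstring : ∀ {σ} → List (Fin σ) → List (Fin σ) → Set
IsSubstring P T = ∃[ i ] IsPrefix P (drop i T)

IsSuffix : ∀ {σ} → List (Fin σ) → List (Fin σ) → Set
IsSuffix S T = ∃[ i ] drop i T ≡ S

RepeatedSuffix : ∀ {σ} → List (Fin σ) → List (Fin σ) → Set
RepeatedSuffix T S = IsSuffix S T × 2 ≤ occ S T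

-- Trie of all suffixes of T: its nodes are the substrings P of T (identified
-- with their labels str), and the children of P are the nodes P·c.
TrieChild : ∀ {σ} → List (Fin σ) → List (Fin σ) → Fin σ → Set
TrieChild T P c = IsSubstring (P ∷ʳ c) T

Branching : ∀ {σ} → List (Fin σ) → List (Fin σ) → Set
Branching T P = IsSubstring P T × ∃[ a ] ∃[ b ] (a ≢ b × TrieChild T P a × TrieChild T P b)

Leaf : ∀ {σ} → List (Fin σ) → List (Fin σ) → Set
Leaf T P = IsSubstring P T × (∀ c → ¬ TrieChild T P c)

-- Explicit nodes of the implicit suffix tree: root, branching nodes, leaves.
Explicit : ∀ {σ} → List (Fin σ) → List (Fin σ) → Set
Explicit T P = P ≡ [] ⊎ Branching T P ⊎ Leaf T P

-- child(u,y) = v in the implicit suffix tree, where S = str(u), V = str(v):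
-- V is the (unique) shallowest explicit node whose label starts with S·y.
ChildST : ∀ {σ} → List (Fin σ) → List (Fin σ) → Fin σ → List (Fin σ) → Set
ChildST T S y V =
  Explicit T V × IsPrefix (S ∷ʳ y) V ×
  (∀ W → Explicit T W → IsPrefix (S ∷ʳ y) W → IsPrefix W V → W ≡ V)

-- The edge (u,v) (u = parent(v), S = str(u), V = str(v)) contains an implicit
-- node: some locus (v,d), |S| < d ≤ |V|, spells a repeated suffix of T.
EdgeHasImplicit : ∀ {σ} → List (Fin σ) → List (Fin σ) → List (Fin σ) → Set
EdgeHasImplicit T S V =
  ∃[ d ] (length S < d × d ≤ length V × RepeatedSuffix T (take d V))

-- Every substring of T that extends Sy is a prefix of str(v): a letter leaving str(v)
-- below Sy would make a proper prefix of str(v) a branching, hence explicit, node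
-- strictly above v, and a letter after str(v) would give the leaf v a child.  So if
-- Sy occurred at positions i < j, both suffixes T[i..] and T[j..] would be prefixes
-- of str(v); the shorter one, T[j..], is then a prefix of T[i..], i.e. a repeated
-- suffix, and it is spelled by a locus on the edge uv.
module Submission where

open import Defs
open import Data.Bool using (true; false)
open import Data.Empty using (⊥-elim)
open import Data.Fin using (Fin; _≟_)
open import Data.List using (List; []; _∷_; _++_; _∷ʳ_; drop; take; length)
open import Data.List.Properties
  using (++-assoc; ++-identityʳ; ++-identityʳ-unique; ++-conicalˡ; ∷-injective; ∷ʳ-++;
         length-++; length-++-≤ˡ; length-drop)
open import Data.Nat using (ℕ; zero; suc; _+_; _∸_; _≤_; _<_; z≤n; s≤s; z<s; s<s)
open import Data.Nat.Properties
  using (≤-trans; ≤-antisym; ≤-pred; ≰⇒>; <⇒≤; m≤n+m; m<m+n; ∸-monoʳ-≤; module ≤-Reasoning)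
open import Data.Product using (∃-syntax; _×_; _,_; proj₁; proj₂)
open import Data.Sum using (inj₁; inj₂)
open import Relation.Nullary using (¬_; yes; no; contradiction)
open import Relation.Nullary.Decidable using (dec-true)
open import Relation.Binary.PropositionalEquality using (_≡_; _≢_; refl; sym; trans; cong; subst)

module _ {σ : ℕ} where

  private
    Str = List (Fin σ)

  ∷ʳ-≢-[] : ∀ (S : Str) y → S ∷ʳ y ≢ []
  ∷ʳ-≢-[] []      y ()
  ∷ʳ-≢-[] (_ ∷ _) y ()

  prefix-trans : {A B C : Str} → IsPrefix A B → IsPrefix B C → IsPrefix A C
  prefix-trans {A} (R , refl) (R′ , refl) = R ++ R′ , sym (++-assoc A R R′)

  prefix-length : {A B : Str} → IsPrefix A B → length A ≤ length B
  prefix-length {A} (R , refl) = length-++-≤ˡ A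

  prefix-of-[] : {A : Str} → IsPrefix A [] → A ≡ []
  prefix-of-[] {A} (R , e) = ++-conicalˡ A R e

  prefix-of-substring : {A B T : Str} → IsPrefix A B → IsSubstring B T → IsSubstring A T
  prefix-of-substring A⊑B (i , B⊑Tᵢ) = i , prefix-trans A⊑B B⊑Tᵢ

  shorter-prefix-is-prefix : (A B C : Str) → IsPrefix A C → IsPrefix B C →
                             length A ≤ length B → IsPrefix A B
  shorter-prefix-is-prefix []      B       C       _          _          _         = B , refl
  shorter-prefix-is-prefix (a ∷ A) []      C       _          _          ()
  shorter-prefix-is-prefix (a ∷ A) (b ∷ B) (c ∷ C) (R , aAR≡cC) (R′ , bBR′≡cC) (s≤s |A|≤|B|)
    with refl , AR≡C ← ∷-injective aAR≡cC | refl , BR′≡C ← ∷-injective bBR′≡cC =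
    let (R″ , AR″≡B) = shorter-prefix-is-prefix A B C (R , AR≡C) (R′ , BR′≡C) |A|≤|B|
    in  R″ , cong (a ∷_) AR″≡B

  take-length-prefix : {A B : Str} → IsPrefix A B → take (length A) B ≡ A
  take-length-prefix {[]}    _          = refl
  take-length-prefix {a ∷ A} (R , refl) = cong (a ∷_) (take-length-prefix (R , refl))

  prefixᵇ⇒IsPrefix : (A B : Str) → prefixᵇ A B ≡ true → IsPrefix A B
  prefixᵇ⇒IsPrefix []      B       _ = B , refl
  prefixᵇ⇒IsPrefix (a ∷ A) []      ()
  prefixᵇ⇒IsPrefix (a ∷ A) (b ∷ B) e with a ≟ b
  ... | yes refl = let (R , AR≡B) = prefixᵇ⇒IsPrefix A B e in R , cong (a ∷_) AR≡B
  prefixᵇ⇒IsPrefix (a ∷ A) (b ∷ B) () | no _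

  IsPrefix⇒prefixᵇ : (A B : Str) → IsPrefix A B → prefixᵇ A B ≡ true
  IsPrefix⇒prefixᵇ []      B                 _          = refl
  IsPrefix⇒prefixᵇ (a ∷ A) .(a ∷ A ++ R) (R , refl)
    rewrite dec-true (a ≟ a) refl = IsPrefix⇒prefixᵇ A (A ++ R) (R , refl)

  -- Unlike occ, OccursAt does not bound i by |T|; the two agree only for P ≢ [].
  OccursAt : Str → Str → ℕ → Set
  OccursAt P T i = IsPrefix P (drop i T)

  occursAt-[] : (P : Str) (i : ℕ) → OccursAt P [] i → P ≡ []
  occursAt-[] P zero    = prefix-of-[]
  occursAt-[] P (suc i) = prefix-of-[]

  IsSubstring⇒1≤occ : (P T : Str) → P ≢ [] → IsSubstring P T → 1 ≤ occ P T
  IsSubstring⇒1≤occ P []      P≢[] (i , Pᵢ)     = contradiction (occursAt-[] P i Pᵢ) P≢[]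
  IsSubstring⇒1≤occ P (x ∷ T) _    (zero , P₀)
    rewrite IsPrefix⇒prefixᵇ P (x ∷ T) P₀ = s≤s z≤n
  IsSubstring⇒1≤occ P (x ∷ T) P≢[] (suc i , Pᵢ) =
    ≤-trans (IsSubstring⇒1≤occ P T P≢[] (i , Pᵢ)) (m≤n+m _ _)

  1≤occ⇒IsSubstring : (P T : Str) → 1 ≤ occ P T → IsSubstring P T
  1≤occ⇒IsSubstring P (x ∷ T) 1≤occ with prefixᵇ P (x ∷ T) in eq
  ... | true  = 0 , prefixᵇ⇒IsPrefix P (x ∷ T) eq
  ... | false = let (i , Pᵢ) = 1≤occ⇒IsSubstring P T 1≤occ in suc i , Pᵢ

  occursAt-twice⇒2≤occ : (P T : Str) {i j : ℕ} → P ≢ [] → i < j →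
                         OccursAt P T i → OccursAt P T j → 2 ≤ occ P T
  occursAt-twice⇒2≤occ P []      {i} P≢[] _ Pᵢ _ = contradiction (occursAt-[] P i Pᵢ) P≢[]
  occursAt-twice⇒2≤occ P (x ∷ T) {zero} {suc j} P≢[] _ P₀ Pⱼ
    rewrite IsPrefix⇒prefixᵇ P (x ∷ T) P₀ = s≤s (IsSubstring⇒1≤occ P T P≢[] (j , Pⱼ))
  occursAt-twice⇒2≤occ P (x ∷ T) {suc i} {suc j} P≢[] (s<s i<j) Pᵢ Pⱼ =
    ≤-trans (occursAt-twice⇒2≤occ P T P≢[] i<j Pᵢ Pⱼ) (m≤n+m _ _)

  2≤occ⇒occursAt-twice : (P T : Str) → 2 ≤ occ P T →
                         ∃[ i ] ∃[ j ] (i < j × OccursAt P T i × OccursAt P T j)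
  2≤occ⇒occursAt-twice P (x ∷ T) 2≤occ with prefixᵇ P (x ∷ T) in eq
  ... | true  = let (j , Pⱼ) = 1≤occ⇒IsSubstring P T (≤-pred 2≤occ)
                in  0 , suc j , z<s , prefixᵇ⇒IsPrefix P (x ∷ T) eq , Pⱼ
  ... | false = let (i , j , i<j , Pᵢ , Pⱼ) = 2≤occ⇒occursAt-twice P T 2≤occ
                in  suc i , suc j , s<s i<j , Pᵢ , Pⱼ

  later-suffix-repeated : (T : Str) {i j : ℕ} → i < j → drop j T ≢ [] →
                          IsPrefix (drop j T) (drop i T) → RepeatedSuffix T (drop j T)
  later-suffix-repeated T {j = j} i<j Tⱼ≢[] Tⱼ⊑Tᵢ =
    (j , refl) , occursAt-twice⇒2≤occ (drop j T) T Tⱼ≢[] i<j Tⱼ⊑Tᵢ ([] , ++-identityʳ (drop j T))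

  module EdgeToLeaf (T : Str) {A V : Str} (A⊑V : IsPrefix A V)
    (below : ∀ W → Explicit T W → IsPrefix A W → IsPrefix W V → W ≡ V)
    (leaf : Leaf T V) where

    only-child : {P Q : Str} {q c : Fin σ} → IsPrefix A P → P ++ q ∷ Q ≡ V →
                 TrieChild T P c → c ≡ q
    only-child {P} {Q} {q} {c} A⊑P PqQ≡V Pc with c ≟ q
    ... | yes c≡q = c≡q
    ... | no  c≢q = contradiction (++-identityʳ-unique P (trans P≡V (sym PqQ≡V))) λ ()
      where
        Pq : TrieChild T P q
        Pq = prefix-of-substring (Q , trans (∷ʳ-++ P q Q) PqQ≡V) (proj₁ leaf)

        P-branching : Branching T P
        P-branching = prefix-of-substring (q ∷ Q , PqQ≡V) (proj₁ leaf) , c , q , c≢q , Pc , Pq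

        P≡V : P ≡ V
        P≡V = below P (inj₂ (inj₁ P-branching)) A⊑P (q ∷ Q , PqQ≡V)

    extension-is-prefix : (P Q R : Str) → IsPrefix A P → P ++ Q ≡ V →
                          IsSubstring (P ++ R) T → IsPrefix (P ++ R) V
    extension-is-prefix P Q [] _ PQ≡V _ = Q , trans (cong (_++ Q) (++-identityʳ P)) PQ≡V
    extension-is-prefix P [] (c ∷ R) _ P[]≡V PcR =
      ⊥-elim (proj₂ leaf c (subst (λ X → TrieChild T X c) P≡V Pc))
      where
        P≡V : P ≡ V
        P≡V = trans (sym (++-identityʳ P)) P[]≡V

        Pc : TrieChild T P c
        Pc = prefix-of-substring (R , ∷ʳ-++ P c R) PcR
    extension-is-prefix P (q ∷ Q) (c ∷ R) A⊑P PqQ≡V PcR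
      with refl ← only-child A⊑P PqQ≡V (prefix-of-substring (R , ∷ʳ-++ P c R) PcR) =
      subst (λ X → IsPrefix X V) (∷ʳ-++ P q R)
        (extension-is-prefix (P ∷ʳ q) Q R
          (prefix-trans A⊑P (q ∷ [] , refl))
          (trans (∷ʳ-++ P q Q) PqQ≡V)
          (subst (λ X → IsSubstring X T) (sym (∷ʳ-++ P q R)) PcR))

    substring-is-prefix : {X : Str} → IsPrefix A X → IsSubstring X T → IsPrefix X V
    substring-is-prefix {X} (R , refl) X-sub =
      extension-is-prefix A (proj₁ A⊑V) R ([] , ++-identityʳ A) (proj₂ A⊑V) X-sub

  two-occurrences⇒EdgeHasImplicit :
    (T S V : Str) (y : Fin σ) → IsPrefix (S ∷ʳ y) V →
    (∀ W → Explicit T W → IsPrefix (S ∷ʳ y) W → IsPrefix W V → W ≡ V) → Leaf T V →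
    {i j : ℕ} → i < j → OccursAt (S ∷ʳ y) T i → OccursAt (S ∷ʳ y) T j → EdgeHasImplicit T S V
  two-occurrences⇒EdgeHasImplicit T S V y Sy⊑V below leaf {i} {j} i<j Syᵢ Syⱼ =
    length Tⱼ , |S|<|Tⱼ| , prefix-length Tⱼ⊑V ,
    subst (RepeatedSuffix T) (sym (take-length-prefix Tⱼ⊑V))
      (later-suffix-repeated T i<j Tⱼ≢[] Tⱼ⊑Tᵢ)
    where
      open EdgeToLeaf T Sy⊑V below leaf
      open ≤-Reasoning

      Tᵢ Tⱼ : Str
      Tᵢ = drop i T
      Tⱼ = drop j T

      Tᵢ⊑V : IsPrefix Tᵢ V
      Tᵢ⊑V = substring-is-prefix Syᵢ (i , [] , ++-identityʳ Tᵢ)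

      Tⱼ⊑V : IsPrefix Tⱼ V
      Tⱼ⊑V = substring-is-prefix Syⱼ (j , [] , ++-identityʳ Tⱼ)

      |Tⱼ|≤|Tᵢ| : length Tⱼ ≤ length Tᵢ
      |Tⱼ|≤|Tᵢ| = begin
        length Tⱼ     ≡⟨ length-drop j T ⟩
        length T ∸ j  ≤⟨ ∸-monoʳ-≤ (length T) (<⇒≤ i<j) ⟩
        length T ∸ i  ≡⟨ length-drop i T ⟨
        length Tᵢ     ∎

      Tⱼ⊑Tᵢ : IsPrefix Tⱼ Tᵢ
      Tⱼ⊑Tᵢ = shorter-prefix-is-prefix Tⱼ Tᵢ V Tⱼ⊑V Tᵢ⊑V |Tⱼ|≤|Tᵢ|

      Tⱼ≢[] : Tⱼ ≢ []
      Tⱼ≢[] Tⱼ≡[] = ∷ʳ-≢-[] S y (prefix-of-[] (subst (IsPrefix (S ∷ʳ y)) Tⱼ≡[] Syⱼ))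

      |S|<|Tⱼ| : length S < length Tⱼ
      |S|<|Tⱼ| = begin-strict
        length S         <⟨ m<m+n (length S) z<s ⟩
        length S + 1     ≡⟨ length-++ S ⟨
        length (S ∷ʳ y)  ≤⟨ prefix-length Syⱼ ⟩
        length Tⱼ        ∎

proposition2 : {σ : ℕ} (T : List (Fin σ)) (S V : List (Fin σ)) (y : Fin σ) →
    Branching T S → ChildST T S y V → Leaf T V → ¬ EdgeHasImplicit T S V →
    occ (S ∷ʳ y) T ≡ 1
proposition2 T S V y _ (_ , Sy⊑V , below) leaf noImplicit = ≤-antisym occ≤1 1≤occ
  where
    1≤occ : 1 ≤ occ (S ∷ʳ y) T
    1≤occ = IsSubstring⇒1≤occ (S ∷ʳ y) T (∷ʳ-≢-[] S y) (prefix-of-substring Sy⊑V (proj₁ leaf))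

    ¬2≤occ : ¬ 2 ≤ occ (S ∷ʳ y) T
    ¬2≤occ 2≤occ =
      let (i , j , i<j , Syᵢ , Syⱼ) = 2≤occ⇒occursAt-twice (S ∷ʳ y) T 2≤occ
      in  noImplicit (two-occurrences⇒EdgeHasImplicit T S V y Sy⊑V below leaf i<j Syᵢ Syⱼ)

    occ≤1 : occ (S ∷ʳ y) T ≤ 1
    occ≤1 = ≤-pred (≰⇒> ¬2≤occ)
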